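{- Let $\alpha\geq\omega$ and $0<\gamma<\omega$ be ordinals in Cantor normal form below $\varepsilon_0$, and use fundamental sequences with $\omega_x=x$. Then for all $x\in\mathbb{N}$, $F_{\gamma+\alpha}(x)\leq F_\alpha(x+\gamma)$, where $\gamma+\alpha$ is understood as the ordinal term $\underbrace{1+\cdots+1}_{\gamma}+\alpha$ (not as its ordinal value).
   Context: Ordinal terms follow $\alpha::=0\mid\omega^\alpha\mid\alpha+\alpha$, modulo associativity and with $0$ neutral; $1=\omega^0$. Terms $\delta+1$ are successors; other nonzero terms are limits $\delta+\omega^\beta$ with $\beta\neq0$. Fundamental sequences (with $\omega_x=x$): $(\delta+\omega^{\beta+1})_x=\delta+\omega^\beta\cdot x$ and $(\delta+\omega^{\lambda})_x=\delta+\omega^{\lambda_x}$. The fast-growing hierarchy on terms: $F_0(x)=x+1$, $F_{\beta+1}(x)=F_\beta^{x}(x)$ ($x$-fold iterate), $F_\lambda(x)=F_{\lambda_x}(x)$; it is defined syntactically on terms, so terms denoting the same ordinal may give different functions. -}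

module Defs where

open import Data.Nat using (ℕ; zero; suc)
open import Data.Sum using (_⊎_)
open import Relation.Binary.PropositionalEquality using (_≡_)

-- Ordinal terms  α ::= 0 | ω^α | α + α  modulo associativity, 0 neutral.
-- Canonical representative: a (right-nested) list of summands ω^β.
--   𝟎          = 0
--   ω^ β + r   = ω^β + r

infixr 5 ω^_+_
data OT : Set where
  𝟎     : OT
  ω^_+_ : OT → OT → OT

infixr 5 _⊕_
_⊕_ : OT → OT → OT
𝟎         ⊕ b = b
(ω^ e + r) ⊕ b = ω^ e + (r ⊕ b)

𝟏 : OT
𝟏 = ω^ 𝟎 + 𝟎

ω : OT
ω = ω^ 𝟏 + 𝟎

natTerm : ℕ → OT
natTerm zero    = 𝟎
natTerm (suc n) = ω^ 𝟎 + natTerm n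

infix 4 _<ₒ_ _≤ₒ_
data _<ₒ_ : OT → OT → Set where
  0<   : ∀ {b r} → 𝟎 <ₒ ω^ b + r
  exp< : ∀ {b r b' r'} → b <ₒ b' → ω^ b + r <ₒ ω^ b' + r'
  tl<  : ∀ {b r r'} → r <ₒ r' → ω^ b + r <ₒ ω^ b + r'

_≤ₒ_ : OT → OT → Set
a ≤ₒ b = a <ₒ b ⊎ a ≡ b

data CNF : OT → Set where
  cnf0 : CNF 𝟎
  cnf1 : ∀ {b} → CNF b → CNF (ω^ b + 𝟎)
  cnf2 : ∀ {b c r} → CNF b → c ≤ₒ b → CNF (ω^ c + r) → CNF (ω^ b + ω^ c + r)

-- To obtain structural recursion, each term is unfolded into a Brouwer
-- tree whose successor/limit nodes are EXACTLY (definitionally) the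
-- predecessors / fundamental sequences of the term:
--   toTree (δ + 1)            = s (toTree δ)
--   toTree (δ + ω^(β+1))      = lim (λ x → toTree (δ + ω^β·x))
--   toTree (δ + ω^λ)          = lim (λ x → toTree (δ + ω^(λ_x)))
-- (with ω^β·x the x-fold term sum ω^β + ⋯ + ω^β).

data Tree : Set where
  z   : Tree
  s   : Tree → Tree
  lim : (ℕ → Tree) → Tree

infixr 5 _+T_
_+T_ : Tree → Tree → Tree
a +T z     = a
a +T s b   = s (a +T b)
a +T lim g = lim (λ x → a +T g x)

mutual
  ωT : Tree → Tree
  ωT z       = s z
  ωT (s e)   = lim (λ x → rep e x)
  ωT (lim g) = lim (λ x → ωT (g x))

  -- the tree of the term ω^e + ⋯ + ω^e + 0  (x summands)
  rep : Tree → ℕ → Tree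
  rep e zero    = z
  rep e (suc x) = ωT e +T rep e x

toTree : OT → Tree
toTree 𝟎          = z
toTree (ω^ b + r) = ωT (toTree b) +T toTree r

iter : ℕ → (ℕ → ℕ) → ℕ → ℕ
iter zero    f a = a
iter (suc n) f a = f (iter n f a)

FT : Tree → ℕ → ℕ
FT z       x = suc x
FT (s t)   x = iter x (FT t) x
FT (lim g) x = FT (g x) x

F : OT → ℕ → ℕ
F α = FT (toTree α)

module Submission where

-- Terms are evaluated through their Brouwer trees
-- (Defs.toTree), and prefixing the term 1 + ⋯ + 1 (n summands) to α
-- corresponds to the tree operation  pad n T = 1 +T (1 +T ⋯ (1 +T T)).
-- The claim is proved for trees in the strengthened form
--      F_{pad n T}(x) + n ≤ F_T(x + n),
-- by induction on a proof that T is "transfinite": T reaches the tree of ω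
-- through successors and positive indices of fundamental sequences.
--   1. Iteration facts for strictly increasing, inflationary functions.
--   2. Padding commutes with successor and limit nodes.
--   3. "Good" trees (each fundamental sequence descends step by step) have
--      strictly increasing F_T that grow along fundamental sequences;
--      every term tree is good.
--   4. Trees of terms ≥ ω are transfinite.
--   5. The strengthened inequality, from which lemma14 follows at once.

open import Defs
open import Data.Nat using (ℕ; _+_; _≤_; _<_)
open import Data.Nat using (zero; suc; s≤s; _≤′_; ≤′-refl; ≤′-step)
open import Data.Nat.Properties
open import Data.Sum using (inj₁; inj₂)
open import Relation.Binary.PropositionalEquality using (_≡_; refl; cong)

StrictlyIncreasing : (ℕ → ℕ) → Set
StrictlyIncreasing f = ∀ y → f y < f (suc y)

Inflationary : (ℕ → ℕ) → Set
Inflationary f = ∀ y → y ≤ f y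

mono : ∀ {f} → StrictlyIncreasing f → ∀ {a b} → a ≤ b → f a ≤ f b
mono {f} inc {a} a≤b = go (≤⇒≤′ a≤b)
  where
  go : ∀ {b} → a ≤′ b → f a ≤ f b
  go ≤′-refl      = ≤-refl
  go (≤′-step a≤b) = ≤-trans (go a≤b) (<⇒≤ (inc _))

shift : ∀ {f} → StrictlyIncreasing f → ∀ x n → f x + n ≤ f (x + n)
shift {f} inc x zero rewrite +-identityʳ (f x) | +-identityʳ x = ≤-refl
shift {f} inc x (suc n) = begin
  f x + suc n        ≡⟨ +-suc (f x) n ⟩
  suc (f x + n)      ≤⟨ s≤s (shift inc x n) ⟩
  suc (f (x + n))    ≤⟨ inc (x + n) ⟩
  f (suc (x + n))    ≡⟨ cong f (+-suc x n) ⟨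
  f (x + suc n)      ∎
  where open ≤-Reasoning

iter-smono : ∀ {f} → StrictlyIncreasing f → ∀ k {a b} → a < b → iter k f a < iter k f b
iter-smono inc zero    a<b = a<b
iter-smono inc (suc k) a<b = <-≤-trans (inc _) (mono inc (iter-smono inc k a<b))

iter-infl : ∀ {f} → Inflationary f → ∀ k y → y ≤ iter k f y
iter-infl infl zero    y = ≤-refl
iter-infl infl (suc k) y = ≤-trans (iter-infl infl k y) (infl _)

iter-more : ∀ {f} → Inflationary f → ∀ {k m} y → k ≤′ m → iter k f y ≤ iter m f y
iter-more infl y ≤′-refl      = ≤-refl
iter-more infl y (≤′-step k≤m) = ≤-trans (iter-more infl y k≤m) (infl _)

iter-dominate : ∀ {f g} N → StrictlyIncreasing g → (∀ y → f y + N ≤ g (y + N)) →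
  ∀ k x → iter k f x + N ≤ iter k g (x + N)
iter-dominate N inc dom zero    x = ≤-refl
iter-dominate N inc dom (suc k) x = ≤-trans (dom _) (mono inc (iter-dominate N inc dom k x))

pad : ℕ → Tree → Tree
pad zero    T = T
pad (suc n) T = s z +T pad n T

toTree-pad : ∀ n α → toTree (natTerm n ⊕ α) ≡ pad n (toTree α)
toTree-pad zero    α = refl
toTree-pad (suc n) α = cong (s z +T_) (toTree-pad n α)

-- Padding acts on the right end of a tree, so it commutes with its
-- outermost successor or limit node.
pad-s : ∀ n t → pad n (s t) ≡ s (pad n t)
pad-s zero    t = refl
pad-s (suc n) t = cong (s z +T_) (pad-s n t)

pad-lim : ∀ n g → pad n (lim g) ≡ lim (λ x → pad n (g x))
pad-lim zero    g = refl
pad-lim (suc n) g = cong (s z +T_) (pad-lim n g)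

-- The x-th element of the fundamental sequence of ω is the tree of x ones.
pad-rep : ∀ n x → pad n (rep z x) ≡ rep z (n + x)
pad-rep zero    x = refl
pad-rep (suc n) x = cong (s z +T_) (pad-rep n x)

FT-infl : ∀ t → Inflationary (FT t)
FT-infl z       y = n≤1+n y
FT-infl (s t)   y = iter-infl (FT-infl t) y y
FT-infl (lim g) y = FT-infl (g y) y

FT-at-zero : ∀ a T → FT (s a +T T) 0 ≡ 0
FT-at-zero a z       = refl
FT-at-zero a (s T)   = refl
FT-at-zero a (lim g) = FT-at-zero a (g 0)

-- Good trees: every fundamental sequence descends step by step, in the
-- sense that g x is reached from g (x+1) by taking predecessors and
-- elements of index 1 of fundamental sequences.

infix 4 _⇝_
data _⇝_ : Tree → Tree → Set where
  ⇝refl : ∀ {t} → t ⇝ t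
  ⇝s    : ∀ {u t} → u ⇝ t → s u ⇝ t
  ⇝lim  : ∀ {g t} → g 1 ⇝ t → lim g ⇝ t

⇝z : ∀ t → t ⇝ z
⇝z z       = ⇝refl
⇝z (s t)   = ⇝s (⇝z t)
⇝z (lim g) = ⇝lim (⇝z (g 1))

⇝-+T : ∀ {a u t} → u ⇝ t → a +T u ⇝ a +T t
⇝-+T ⇝refl    = ⇝refl
⇝-+T (⇝s d)   = ⇝s (⇝-+T d)
⇝-+T (⇝lim d) = ⇝lim (⇝-+T d)

⇝-ωT : ∀ {u t} → u ⇝ t → ωT u ⇝ ωT t
⇝-ωT ⇝refl    = ⇝refl
⇝-ωT (⇝s d)   = ⇝lim (⇝-ωT d)
⇝-ωT (⇝lim d) = ⇝lim (⇝-ωT d)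

⇝-rep : ∀ e x → rep e (suc x) ⇝ rep e x
⇝-rep e zero    = ⇝z (ωT e)
⇝-rep e (suc x) = ⇝-+T (⇝-rep e x)

data Good : Tree → Set where
  good-z   : Good z
  good-s   : ∀ {t} → Good t → Good (s t)
  good-lim : ∀ {g} → (∀ x → Good (g x)) → (∀ x → g (suc x) ⇝ g x) → Good (lim g)

good-+T : ∀ {a t} → Good a → Good t → Good (a +T t)
good-+T ga good-z          = ga
good-+T ga (good-s gt)     = good-s (good-+T ga gt)
good-+T ga (good-lim gg d) = good-lim (λ x → good-+T ga (gg x)) (λ x → ⇝-+T (d x))

mutual
  good-ωT : ∀ {t} → Good t → Good (ωT t)
  good-ωT good-z          = good-s good-z
  good-ωT {s e} (good-s ge) = good-lim (good-rep (good-ωT ge)) (⇝-rep e)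
  good-ωT (good-lim gg d) = good-lim (λ x → good-ωT (gg x)) (λ x → ⇝-ωT (d x))

  good-rep : ∀ {e} → Good (ωT e) → ∀ x → Good (rep e x)
  good-rep g zero    = good-z
  good-rep g (suc x) = good-+T g (good-rep g x)

good-toTree : ∀ α → Good (toTree α)
good-toTree 𝟎          = good-z
good-toTree (ω^ b + r) = good-+T (good-ωT (good-toTree b)) (good-toTree r)

mutual
  FT-increasing : ∀ {t} → Good t → StrictlyIncreasing (FT t)
  FT-increasing good-z y = n<1+n (suc y)
  FT-increasing {s t} (good-s gt) y =
    <-≤-trans (iter-smono (FT-increasing gt) y (n<1+n y)) (FT-infl t _)
  FT-increasing (good-lim gg d) y =
    <-≤-trans (FT-increasing (gg y) y) (FT-descend (gg (suc y)) (d y) y)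

  FT-descend : ∀ {u t} → Good u → u ⇝ t → ∀ y → FT t (suc y) ≤ FT u (suc y)
  FT-descend gu ⇝refl y = ≤-refl
  FT-descend {s u} (good-s gu) (⇝s d) y =
    ≤-trans (FT-descend gu d y)
      (mono (FT-increasing gu) (iter-infl (FT-infl u) y (suc y)))
  FT-descend (good-lim gg c) (⇝lim d) y =
    ≤-trans (FT-descend (gg 1) d y)
      (FT-index-mono (good-lim gg c) (s≤′s z≤′n) y)

  FT-index-mono : ∀ {g} → Good (lim g) → ∀ {k m} → k ≤′ m → ∀ y →
    FT (g k) (suc y) ≤ FT (g m) (suc y)
  FT-index-mono gl ≤′-refl y = ≤-refl
  FT-index-mono (good-lim gg d) {m = suc m} (≤′-step k≤m) y =
    ≤-trans (FT-index-mono (good-lim gg d) k≤m y) (FT-descend (gg (suc m)) (d m) y)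

data Transfinite : Tree → Set where
  tf-ω   : Transfinite (lim (rep z))
  tf-s   : ∀ {t} → Transfinite t → Transfinite (s t)
  tf-lim : ∀ {g} → (∀ x → Transfinite (g (suc x))) → Transfinite (lim g)

tf-+T : ∀ {a} → Transfinite a → ∀ t → Transfinite (a +T t)
tf-+T w z       = w
tf-+T w (s t)   = tf-s (tf-+T w t)
tf-+T w (lim g) = tf-lim (λ x → tf-+T w (g (suc x)))

tf-ωT-+T : ∀ {A} → Transfinite (ωT A) → ∀ D → Transfinite (ωT (A +T D))
tf-ωT-+T w z       = w
tf-ωT-+T w (s D)   = tf-lim (λ x → tf-+T (tf-ωT-+T w D) (rep _ x))
tf-ωT-+T w (lim h) = tf-lim (λ x → tf-ωT-+T w (h (suc x)))

tf-ωTωT : ∀ C → Transfinite (ωT (ωT C))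
tf-ωTωT z       = tf-ω
tf-ωTωT (s C)   = tf-lim (λ x → tf-ωT-+T (tf-ωTωT C) (rep C x))
tf-ωTωT (lim h) = tf-lim (λ x → tf-ωTωT (h (suc x)))

-- A term ≥ ω has leading exponent ≠ 0, hence a transfinite tree.
tf-toTree : ∀ α → ω ≤ₒ α → Transfinite (toTree α)
tf-toTree 𝟎 (inj₁ ())
tf-toTree 𝟎 (inj₂ ())
tf-toTree (ω^ 𝟎 + r) (inj₁ (exp< ()))
tf-toTree (ω^ 𝟎 + r) (inj₂ ())
tf-toTree (ω^ (ω^ c + d) + r) _ =
  tf-+T (tf-ωT-+T (tf-ωTωT (toTree c)) (toTree d)) (toTree r)

-- At argument 0 a nontrivial padding evaluates to 0, so the bound is
-- just inflationarity of F_T.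
padded-at-zero : ∀ T n → FT (pad n T) 0 + n ≤ FT T n
padded-at-zero T zero    = ≤-reflexive (+-identityʳ (FT T 0))
padded-at-zero T (suc n) = begin
  FT (pad (suc n) T) 0 + suc n ≡⟨ cong (_+ suc n) (FT-at-zero z (pad n T)) ⟩
  suc n                        ≤⟨ FT-infl T (suc n) ⟩
  FT T (suc n)                 ∎
  where open ≤-Reasoning

-- The strengthened inequality, by induction on the transfinite tree: at ω
-- both sides are F on finite trees of the same length, at successors the
-- bound is iterated, at limits it is followed by growth along the sequence.
padded : ∀ {T} → Good T → Transfinite T → ∀ n x → FT (pad n T) x + n ≤ FT T (x + n)
padded {T} _ _ n zero = padded-at-zero T n
padded (good-lim gg _) tf-ω n (suc x) = begin
  FT (pad n (lim (rep z))) (suc x) + n ≡⟨ cong (λ t → FT t (suc x) + n) (pad-lim n (rep z)) ⟩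
  FT (pad n (rep z (suc x))) (suc x) + n ≡⟨ cong (λ t → FT t (suc x) + n) (pad-rep n (suc x)) ⟩
  FT (rep z (n + suc x)) (suc x) + n ≤⟨ shift (FT-increasing (gg (n + suc x))) (suc x) n ⟩
  FT (rep z (n + suc x)) (suc x + n) ≡⟨ cong (λ m → FT (rep z m) (suc x + n)) (+-comm n (suc x)) ⟩
  FT (rep z (suc x + n)) (suc x + n) ∎
  where open ≤-Reasoning
padded {s t} (good-s gt) (tf-s w) n (suc x) = begin
  FT (pad n (s t)) (suc x) + n         ≡⟨ cong (λ u → FT u (suc x) + n) (pad-s n t) ⟩
  iter (suc x) (FT (pad n t)) (suc x) + n
    ≤⟨ iter-dominate n (FT-increasing gt) (padded gt w n) (suc x) (suc x) ⟩
  iter (suc x) (FT t) (suc x + n)      ≤⟨ iter-more (FT-infl t) _ (≤⇒≤′ (m≤m+n (suc x) n)) ⟩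
  iter (suc x + n) (FT t) (suc x + n)  ∎
  where open ≤-Reasoning
padded {lim g} (good-lim gg d) (tf-lim w) n (suc x) = begin
  FT (pad n (lim g)) (suc x) + n       ≡⟨ cong (λ u → FT u (suc x) + n) (pad-lim n g) ⟩
  FT (pad n (g (suc x))) (suc x) + n   ≤⟨ padded (gg (suc x)) (w x) n (suc x) ⟩
  FT (g (suc x)) (suc x + n)
    ≤⟨ FT-index-mono (good-lim gg d) (≤⇒≤′ (s≤s (m≤m+n x n))) (x + n) ⟩
  FT (g (suc x + n)) (suc x + n)       ∎
  where open ≤-Reasoning

lemma14 : (α : OT) → CNF α → ω ≤ₒ α → (n : ℕ) → 0 < n → (x : ℕ) →
    F (natTerm n ⊕ α) x ≤ F α (x + n)
lemma14 α _ ω≤α n _ x = begin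
  F (natTerm n ⊕ α) x          ≡⟨ cong (λ t → FT t x) (toTree-pad n α) ⟩
  FT (pad n (toTree α)) x      ≤⟨ m≤m+n _ n ⟩
  FT (pad n (toTree α)) x + n  ≤⟨ padded (good-toTree α) (tf-toTree α ω≤α) n x ⟩
  F α (x + n)                  ∎
  where open ≤-Reasoning
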